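{- In the revocable setting of OWNM, even when all weights equal $1$, no deterministic online algorithm can achieve a competitive ratio better than $2/3$.
   Context: Online Weighted Non-Crossing Matching (OWNM): the input is a sequence $p_1,\dots,p_{2n}$ of points in the Euclidean plane in general position, revealed online one at a time; when $p_i$ arrives its weight $w(p_i)>0$ is revealed. Upon arrival an algorithm either leaves $p_i$ unmatched or matches it with a previously arrived, currently unmatched point, subject to the constraint that the straight-line segments joining matched pairs are pairwise non-crossing. Revocable setting: when a new point arrives, the algorithm may first (irrevocably) remove one existing edge from the current matching, making its endpoints unmatched and available, and then process the new point. The profit $\textsc{ALG}(I)$ is the total weight of the points matched in the final matching; $\textsc{OPT}(I)=\sum_i w(p_i)$. A deterministic algorithm is $\rho$-competitive if there is a constant $c$ with $\textsc{ALG}(I)\ge\rho\,\textsc{OPT}(I)-c$ for all $I$; the competitive ratio is the supremum of such $\rho$. -}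

module Defs where

open import Data.Nat as ℕ using (ℕ; zero; suc)
open import Data.Fin using (Fin)
open import Data.Integer using (+_)
open import Data.Rational using (ℚ; 0ℚ; 1ℚ; _+_; _-_; _*_; _≤_; _<_; _/_)
open import Data.List using (List; []; _∷_; length; lookup; foldr; map; _∷ʳ_)
open import Data.List.Relation.Unary.All using (All)
open import Data.List.Relation.Binary.Permutation.Propositional using (_↭_)
open import Data.Product using (Σ; ∃; _×_; _,_)
open import Data.Sum using (_⊎_)
open import Relation.Binary.PropositionalEquality using (_≡_; _≢_)
open import Relation.Nullary using (¬_)

record WPoint : Set where
  constructor wpt
  field
    x : ℚ
    y : ℚ
    w : ℚ
open WPoint public

Input : Set
Input = List WPoint

-- total accessor; out-of-range indices are never used for valid edges
at : Input → ℕ → WPoint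
at []       _       = wpt 0ℚ 0ℚ 0ℚ
at (p ∷ ps) zero    = p
at (p ∷ ps) (suc i) = at ps i

OnSegment : WPoint → WPoint → WPoint → Set
OnSegment a b q = Σ ℚ λ t → (0ℚ ≤ t) × (t ≤ 1ℚ) ×
  (x q ≡ x a + t * (x b - x a)) × (y q ≡ y a + t * (y b - y a))

SegmentsIntersect : WPoint → WPoint → WPoint → WPoint → Set
SegmentsIntersect a b c d = Σ ℚ λ qx → Σ ℚ λ qy →
  OnSegment a b (wpt qx qy 0ℚ) × OnSegment c d (wpt qx qy 0ℚ)

Collinear : WPoint → WPoint → WPoint → Set
Collinear a b c = (x b - x a) * (y c - y a) ≡ (y b - y a) * (x c - x a)

GeneralPosition : Input → Set
GeneralPosition ps =
  (∀ (i j : Fin (length ps)) → i ≢ j →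
     ¬ (x (lookup ps i) ≡ x (lookup ps j) × y (lookup ps i) ≡ y (lookup ps j))) ×
  (∀ (i j k : Fin (length ps)) → i ≢ j → j ≢ k → i ≢ k →
     ¬ Collinear (lookup ps i) (lookup ps j) (lookup ps k))

Edge : Set
Edge = ℕ × ℕ

Matching : Set
Matching = List Edge

ValidEdge : Input → Edge → Set
ValidEdge ps (i , j) = i ℕ.< j × j ℕ.< length ps

-- a non-crossing matching of (the points of) ps: all edges valid and the
-- closed segments of any two distinct entries are disjoint (this also
-- forces edges to be vertex-disjoint and pairwise distinct)
NonCrossingMatching : Input → Matching → Set
NonCrossingMatching ps M =
  All (ValidEdge ps) M ×
  (∀ (a b : Fin (length M)) → a ≢ b →
     let (i , j) = lookup M a
         (k , l) = lookup M b
     in ¬ SegmentsIntersect (at ps i) (at ps j) (at ps k) (at ps l))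

RemoveStep : Matching → Matching → Set
RemoveStep M M₀ = (M₀ ≡ M) ⊎ (Σ Edge λ e → M ↭ (e ∷ M₀))

AddStep : ℕ → Matching → Matching → Set
AddStep n M₀ M′ = (M′ ≡ M₀) ⊎ (Σ ℕ λ j → (j ℕ.< n) × (M′ ≡ (j , n) ∷ M₀))

RevocableStep : ℕ → Matching → Matching → Set
RevocableStep n M M′ = Σ Matching λ M₀ → RemoveStep M M₀ × AddStep n M₀ M′

-- The matching held after the prefix ps has been revealed is a function
-- of ps only (determinism + online-ness); consecutive matchings are
-- related by one revocable step, and every matching held is a valid
-- non-crossing matching.

record RevocableAlgorithm : Set where
  field
    run       : Input → Matching
    run-empty : run [] ≡ []
    run-step  : ∀ ps p → RevocableStep (length ps) (run ps) (run (ps ∷ʳ p))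
    run-valid : ∀ ps → NonCrossingMatching ps (run ps)
open RevocableAlgorithm public

profit : Input → Matching → ℚ
profit ps M = foldr (λ { (i , j) acc → w (at ps i) + w (at ps j) + acc }) 0ℚ M

OPT : Input → ℚ
OPT ps = foldr (λ p acc → w p + acc) 0ℚ ps

ALG : RevocableAlgorithm → Input → ℚ
ALG A ps = profit ps (run A ps)

UnitInstance : Input → Set
UnitInstance ps =
  (Σ ℕ λ n → length ps ≡ 2 ℕ.* n) × GeneralPosition ps × All (λ p → w p ≡ 1ℚ) ps

Competitive : RevocableAlgorithm → ℚ → Set
Competitive A ρ = Σ ℚ λ c → ∀ ps → UnitInstance ps → ρ * OPT ps - c ≤ ALG A ps

twoThirds : ℚ
twoThirds = + 2 / 3

{-# OPTIONS --safe #-}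
module Submission where

-- Put every point on the parabola y = x². Two chords of the parabola cross as soon as
-- one of them has exactly one endpoint strictly inside the x-interval of the other, so
-- the geometry becomes one-dimensional. Call a position z a pocket of the current
-- matching M if every free point is separated from z by an edge of M in this sense: a
-- point arriving in a pocket can only be matched after revoking an edge, so |M| does
-- not grow. The adversary looks for a pocket among m + 1 candidates: far to the left,
-- and just to the right of the left endpoint of each of the m edges. If none of them is
-- a pocket, each candidate sees a free point, and these free points are pairwise
-- distinct, so at least 3m + 1 points have arrived. Either way 3|M| ≤ n + 1 after
-- n points, hence ALG ≤ (2/3)(n + 1) while OPT = n.

open import Defs
open import Algebra.Definitions using (Selective)
open import Data.Empty using (⊥-elim)
open import Data.Fin as Fin using (Fin; toℕ; fromℕ<)
import Data.Fin.Properties as Fin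
open import Data.Integer as ℤ using (+_)
import Data.Integer.Properties as ℤ
open import Data.List using ([]; _∷_; length; lookup; _∷ʳ_)
open import Data.List.Membership.Propositional.Properties using (∈-lookup)
open import Data.List.Relation.Binary.Permutation.Propositional.Properties using (↭-length)
open import Data.List.Relation.Unary.All as All using (All; []; _∷_)
import Data.List.Relation.Unary.All.Properties as All
open import Data.Nat as ℕ using (ℕ; zero; suc)
import Data.Nat.Properties as ℕ
open import Data.Nat.Tactic.RingSolver using () renaming (solve-∀ to ℕ-solve-∀)
open import Data.Product using (∃; _×_; _,_; proj₁; proj₂)
open import Data.Rational as ℚ
  using (ℚ; 0ℚ; 1ℚ; _+_; _-_; _*_; -_; 1/_; _≤_; _<_; _⊓_; _⊔_; *≤*; *<*; NonZero; Positive)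
open import Data.Rational.Literals using (fromℤ)
import Data.Rational.Properties as ℚ
import Data.Rational.Unnormalised as ℚᵘ
import Data.Rational.Unnormalised.Properties as ℚᵘ
open import Data.Sum as Sum using (_⊎_; inj₁; inj₂; [_,_]′)
open import Function using (_∘_; id; Injective; Injection; _⇔_; mk⇔; Equivalence)
open import Function.Properties.Inverse using (↔⇒↣)
open import Level using (0ℓ)
open import Relation.Binary.Definitions using (tri<; tri≈; tri>)
open import Relation.Binary.PropositionalEquality
open import Relation.Nullary using (¬_; Dec; yes; no; ¬?; _×-dec_; _⊎-dec_)
open import Relation.Nullary.Decidable using (dec⇒maybe; decidable-stable; map′)
open import Tactic.RingSolver using (solve-∀)
import Tactic.RingSolver.Core.AlmostCommutativeRing as ACR

open import Algebra.Properties.Group ℚ.+-0-group using (x∙y⁻¹≈ε⇒x≈y; x≈y⇒x∙y⁻¹≈ε)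
open Equivalence using (to; from)

ℚ-ring : ACR.AlmostCommutativeRing 0ℓ 0ℓ
ℚ-ring = ACR.fromCommutativeRing ℚ.+-*-commutativeRing (λ p → dec⇒maybe (0ℚ ℚ.≟ p))

p<q⇒0<q-p : ∀ {p q} → p < q → 0ℚ < q - p
p<q⇒0<q-p {p} {q} p<q = subst (_< q - p) (ℚ.+-inverseʳ p) (ℚ.+-monoˡ-< (- p) p<q)

p≤q⇒0≤q-p : ∀ {p q} → p ≤ q → 0ℚ ≤ q - p
p≤q⇒0≤q-p {p} {q} p≤q = subst (_≤ q - p) (ℚ.+-inverseʳ p) (ℚ.+-monoˡ-≤ (- p) p≤q)

0<q-p⇒p<q : ∀ {p q} → 0ℚ < q - p → p < q
0<q-p⇒p<q {p} {q} 0<q-p = subst₂ _<_ (ℚ.+-identityˡ p) (q-p+p≡q p q) (ℚ.+-monoˡ-< p 0<q-p)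
  where
  q-p+p≡q : ∀ p q → q - p + p ≡ q
  q-p+p≡q = solve-∀ ℚ-ring

p≤p+q : ∀ p {q} → 0ℚ ≤ q → p ≤ p + q
p≤p+q p {q} 0≤q = subst (_≤ p + q) (ℚ.+-identityʳ p) (ℚ.+-monoʳ-≤ p 0≤q)

p<p+q : ∀ p {q} → 0ℚ < q → p < p + q
p<p+q p {q} 0<q = subst (_< p + q) (ℚ.+-identityʳ p) (ℚ.+-monoʳ-< p 0<q)

0≤p*q : ∀ {p q} → 0ℚ ≤ p → 0ℚ ≤ q → 0ℚ ≤ p * q
0≤p*q {p} {q} 0≤p 0≤q =
  ℚ.nonNegative⁻¹ _ {{ℚ.nonNeg*nonNeg⇒nonNeg p {{ℚ.nonNegative 0≤p}} q {{ℚ.nonNegative 0≤q}}}}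

<-⊓ : ∀ {u p q} → u < p → u < q → u < p ⊓ q
<-⊓ {u} {p} {q} u<p u<q =
  [ (λ ⊓≡p → subst (u <_) (sym ⊓≡p) u<p) , (λ ⊓≡q → subst (u <_) (sym ⊓≡q) u<q) ]′
  (ℚ.⊓-sel p q)

⊓<⊔ : ∀ {p q} → p ≢ q → p ⊓ q < p ⊔ q
⊓<⊔ {p} {q} p≢q with ℚ.<-cmp p q
... | tri< p<q _ _ = let p≤q = ℚ.<⇒≤ p<q in subst₂ _<_ (sym (ℚ.p≤q⇒p⊓q≡p p≤q)) (sym (ℚ.p≤q⇒p⊔q≡q p≤q)) p<q
... | tri≈ _ p≡q _ = ⊥-elim (p≢q p≡q)
... | tri> _ _ q<p = let q≤p = ℚ.<⇒≤ q<p in subst₂ _<_ (sym (ℚ.p≥q⇒p⊓q≡q q≤p)) (sym (ℚ.p≥q⇒p⊔q≡p q≤p)) q<p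

p*q≡0⇒p≡0∨q≡0 : ∀ p q → p * q ≡ 0ℚ → p ≡ 0ℚ ⊎ q ≡ 0ℚ
p*q≡0⇒p≡0∨q≡0 p q pq≡0 with p ℚ.≟ 0ℚ
... | yes p≡0 = inj₁ p≡0
... | no p≢0 = inj₂ (begin
  q               ≡⟨ sym (ℚ.*-identityˡ q) ⟩
  1ℚ * q          ≡⟨ cong (_* q) (sym (ℚ.*-inverseˡ p)) ⟩
  1/ p * p * q    ≡⟨ ℚ.*-assoc (1/ p) p q ⟩
  1/ p * (p * q)  ≡⟨ cong (1/ p *_) pq≡0 ⟩
  1/ p * 0ℚ       ≡⟨ ℚ.*-zeroʳ (1/ p) ⟩
  0ℚ              ∎)
  where
  open ≡-Reasoning
  instance _ = ℚ.≢-nonZero p≢0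

fromℕ : ℕ → ℚ
fromℕ n = fromℤ (+ n)

fromℕ-suc : ∀ n → fromℕ (suc n) ≡ 1ℚ + fromℕ n
fromℕ-suc n = ℚ.toℚᵘ-injective (ℚᵘ.≃-sym (ℚᵘ.≃-trans (ℚ.toℚᵘ-homo-+ 1ℚ (fromℕ n))
  (ℚᵘ.*≡* (cong (ℤ._* + 1) (cong (λ k → + 1 ℤ.+ k) (ℤ.*-identityʳ (+ n)))))))

fromℕ-* : ∀ m n → fromℕ (m ℕ.* n) ≡ fromℕ m * fromℕ n
fromℕ-* m n = ℚ.toℚᵘ-injective (ℚᵘ.≃-sym (ℚᵘ.≃-trans (ℚ.toℚᵘ-homo-* (fromℕ m) (fromℕ n))
  (ℚᵘ.*≡* (cong (ℤ._* + 1) (sym (ℤ.pos-* m n))))))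

fromℕ-mono-≤ : ∀ {m n} → m ℕ.≤ n → fromℕ m ≤ fromℕ n
fromℕ-mono-≤ {m} {n} m≤n =
  *≤* (subst₂ ℤ._≤_ (sym (ℤ.*-identityʳ (+ m))) (sym (ℤ.*-identityʳ (+ n))) (ℤ.+≤+ m≤n))

archimedean : ∀ r → ∃ λ n → r < fromℕ n
archimedean (ℚ.mkℚ (+ n) d _) = suc n , *<*
  (subst (ℤ._< + (suc n ℕ.* suc d)) (sym (ℤ.*-identityʳ (+ n))) (ℤ.+<+ (ℕ.m≤m*n (suc n) (suc d))))
archimedean (ℚ.mkℚ ℤ.-[1+ n ] d _) = 0 , *<* ℤ.-<+

t<ρ⇒eventually-t*[1+n]<ρ*n-c : ∀ {t ρ} c → t < ρ →
                               ∃ λ K → t * fromℕ (suc (2 ℕ.* K)) < ρ * fromℕ (2 ℕ.* K) - c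
t<ρ⇒eventually-t*[1+n]<ρ*n-c {t} {ρ} c t<ρ =
  K , 0<q-p⇒p<q (subst (0ℚ <_) rearrange (p<q⇒0<q-p c+t<n*δ))
  where
  open ℚ.≤-Reasoning
  δ = ρ - t
  instance
    δ-pos : Positive δ
    δ-pos = ℚ.positive (p<q⇒0<q-p t<ρ)
    δ≢0 : NonZero δ
    δ≢0 = ℚ.pos⇒nonZero δ
  r = (c + t) * 1/ δ
  K = proj₁ (archimedean r)
  n = fromℕ (2 ℕ.* K)
  c+t<n*δ : c + t < n * δ
  c+t<n*δ = begin-strict
    c + t                ≡⟨ sym (ℚ.*-identityʳ (c + t)) ⟩
    (c + t) * 1ℚ         ≡⟨ cong ((c + t) *_) (sym (ℚ.*-inverseˡ δ)) ⟩
    (c + t) * (1/ δ * δ) ≡⟨ sym (ℚ.*-assoc (c + t) (1/ δ) δ) ⟩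
    r * δ                <⟨ ℚ.*-monoˡ-<-pos δ (proj₂ (archimedean r)) ⟩
    fromℕ K * δ          ≤⟨ ℚ.*-monoʳ-≤-nonNeg δ {{ℚ.pos⇒nonNeg δ}} (fromℕ-mono-≤ (ℕ.m≤n*m K 2)) ⟩
    n * δ                ∎
  rearrange : n * δ - (c + t) ≡ ρ * n - c - t * fromℕ (suc (2 ℕ.* K))
  rearrange = trans (identity ρ c n t) (cong (λ s → ρ * n - c - t * s) (sym (fromℕ-suc (2 ℕ.* K))))
    where
    identity : ∀ ρ c n t → n * (ρ - t) - (c + t) ≡ ρ * n - c - t * (1ℚ + n)
    identity = solve-∀ ℚ-ring

-- Chords of the parabola y = x²

-- A record rather than a synonym, so that the point can be inferred from a proof;
-- the same goes for Between below.
record OnParabola (p : WPoint) : Set where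
  constructor onParabola
  field
    y≡x² : y p ≡ x p * x p

parabola : ℚ → WPoint
parabola z = wpt z (z * z) 1ℚ

parabola-onParabola : ∀ z → OnParabola (parabola z)
parabola-onParabola z = onParabola refl

OnParabola-≡x⇒≡y : ∀ {A B} → OnParabola A → OnParabola B → x A ≡ x B → y A ≡ y B
OnParabola-≡x⇒≡y (onParabola yA≡) (onParabola yB≡) xA≡xB =
  trans yA≡ (trans (cong (λ z → z * z) xA≡xB) (sym yB≡))

module _ (A B : WPoint) where

  onSegment-start : OnSegment A B (wpt (x A) (y A) 0ℚ)
  onSegment-start = 0ℚ , ℚ.≤-refl , ℚ.<⇒≤ (ℚ.positive⁻¹ 1ℚ) , start (x A) (x B) , start (y A) (y B)
    where
    start : ∀ a b → a ≡ a + 0ℚ * (b - a)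
    start = solve-∀ ℚ-ring

  onSegment-end : OnSegment A B (wpt (x B) (y B) 0ℚ)
  onSegment-end = 1ℚ , ℚ.<⇒≤ (ℚ.positive⁻¹ 1ℚ) , ℚ.≤-refl , end (x A) (x B) , end (y A) (y B)
    where
    end : ∀ a b → b ≡ a + 1ℚ * (b - a)
    end = solve-∀ ℚ-ring

  OnSegment-sym : ∀ {qx qy} → OnSegment A B (wpt qx qy 0ℚ) → OnSegment B A (wpt qx qy 0ℚ)
  OnSegment-sym (t , 0≤t , t≤1 , qx≡ , qy≡) =
    1ℚ - t , p≤q⇒0≤q-p t≤1 , ℚ.+-monoʳ-≤ 1ℚ (ℚ.neg-antimono-≤ 0≤t) ,
    trans qx≡ (reverse (x A) (x B) t) , trans qy≡ (reverse (y A) (y B) t)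
    where
    reverse : ∀ a b t → a + t * (b - a) ≡ b + (1ℚ - t) * (a - b)
    reverse = solve-∀ ℚ-ring

module _ (A B C D : WPoint) where

  SegmentsIntersect-sym : SegmentsIntersect A B C D → SegmentsIntersect C D A B
  SegmentsIntersect-sym (qx , qy , onAB , onCD) = qx , qy , onCD , onAB

  SegmentsIntersect-swapˡ : SegmentsIntersect A B C D → SegmentsIntersect B A C D
  SegmentsIntersect-swapˡ (qx , qy , onAB , onCD) = qx , qy , OnSegment-sym A B onAB , onCD

  SegmentsIntersect-swapʳ : SegmentsIntersect A B C D → SegmentsIntersect A B D C
  SegmentsIntersect-swapʳ (qx , qy , onAB , onCD) = qx , qy , onAB , OnSegment-sym C D onCD

  touching⇒SegmentsIntersect : x B ≡ x C → y B ≡ y C → SegmentsIntersect A B C D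
  touching⇒SegmentsIntersect xB≡xC yB≡yC = x B , y B , onSegment-end A B ,
    subst₂ (λ u v → OnSegment C D (wpt u v 0ℚ)) (sym xB≡xC) (sym yB≡yC) (onSegment-start C D)

SegmentsIntersect-cong : ∀ {A A′ B B′ C C′ D D′} → A ≡ A′ → B ≡ B′ → C ≡ C′ → D ≡ D′ →
                         SegmentsIntersect A B C D → SegmentsIntersect A′ B′ C′ D′
SegmentsIntersect-cong refl refl refl refl = id

chord-onSegment : ∀ {A B q} → OnParabola A → OnParabola B → x A < x B → x A ≤ q → q ≤ x B →
                  OnSegment A B (wpt q ((x A + x B) * q - x A * x B) 0ℚ)
chord-onSegment {A} {B} {q} (onParabola yA≡) (onParabola yB≡) a<b a≤q q≤b =
  t , 0≤t , t≤1 , q≡a+t*d , chord≡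
  where
  open ≡-Reasoning
  a = x A
  b = x B
  d = b - a
  instance
    d-pos : Positive d
    d-pos = ℚ.positive (p<q⇒0<q-p a<b)
    d≢0 : NonZero d
    d≢0 = ℚ.pos⇒nonZero d
  0≤1/d : 0ℚ ≤ 1/ d
  0≤1/d = ℚ.<⇒≤ (ℚ.positive⁻¹ (1/ d) {{ℚ.1/pos⇒pos d}})
  t = (q - a) * 1/ d
  t*d≡q-a : t * d ≡ q - a
  t*d≡q-a = begin
    (q - a) * 1/ d * d    ≡⟨ ℚ.*-assoc (q - a) (1/ d) d ⟩
    (q - a) * (1/ d * d)  ≡⟨ cong ((q - a) *_) (ℚ.*-inverseˡ d) ⟩
    (q - a) * 1ℚ          ≡⟨ ℚ.*-identityʳ (q - a) ⟩
    q - a                 ∎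
  0≤t : 0ℚ ≤ t
  0≤t = 0≤p*q (p≤q⇒0≤q-p a≤q) 0≤1/d
  t≤1 : t ≤ 1ℚ
  t≤1 = subst (t ≤_) (ℚ.*-inverseʳ d)
          (ℚ.*-monoʳ-≤-nonNeg (1/ d) {{ℚ.nonNegative 0≤1/d}} (ℚ.+-monoˡ-≤ (- a) q≤b))
  q≡a+t*d : q ≡ a + t * d
  q≡a+t*d = begin
    q            ≡⟨ identity a q ⟩
    a + (q - a)  ≡⟨ cong (λ s → a + s) (sym t*d≡q-a) ⟩
    a + t * d    ∎
    where
    identity : ∀ a q → q ≡ a + (q - a)
    identity = solve-∀ ℚ-ring
  chord≡ : (a + b) * q - a * b ≡ y A + t * (y B - y A)
  chord≡ = begin
    (a + b) * q - a * b          ≡⟨ expand a b q ⟩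
    a * a + (q - a) * (a + b)    ≡⟨ cong (λ s → a * a + s * (a + b)) (sym t*d≡q-a) ⟩
    a * a + t * d * (a + b)      ≡⟨ factor a b t ⟩
    a * a + t * (b * b - a * a)  ≡⟨ cong₂ (λ u v → u + t * (v - u)) (sym yA≡) (sym yB≡) ⟩
    y A + t * (y B - y A)        ∎
    where
    expand : ∀ a b q → (a + b) * q - a * b ≡ a * a + (q - a) * (a + b)
    expand = solve-∀ ℚ-ring
    factor : ∀ a b t → a * a + t * (b - a) * (a + b) ≡ a * a + t * (b * b - a * a)
    factor = solve-∀ ℚ-ring

interleaved-chords-intersect : ∀ {A B C D} → OnParabola A → OnParabola B → OnParabola C → OnParabola D →
                               x A < x C → x C < x B → x B < x D → SegmentsIntersect A B C D
interleaved-chords-intersect {A} {B} {C} {D} pA pB pC pD a<c c<b b<d =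
  q , _ , chord-onSegment pA pB a<b a≤q q≤b ,
  subst (λ v → OnSegment C D (wpt q v 0ℚ)) (sym chords-meet) (chord-onSegment pC pD c<d c≤q q≤d)
  where
  open ≡-Reasoning
  a = x A
  b = x B
  c = x C
  d = x D
  a<b = ℚ.<-trans a<c c<b
  c<d = ℚ.<-trans c<b b<d
  s = (c - a) + (d - b)
  instance
    s-pos : Positive s
    s-pos = ℚ.positive (ℚ.<-≤-trans (p<q⇒0<q-p a<c) (p≤p+q (c - a) (ℚ.<⇒≤ (p<q⇒0<q-p b<d))))
    s≢0 : NonZero s
    s≢0 = ℚ.pos⇒nonZero s
  k = 1/ s
  0≤k : 0ℚ ≤ k
  0≤k = ℚ.<⇒≤ (ℚ.positive⁻¹ k {{ℚ.1/pos⇒pos s}})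
  s*k≡1 : s * k ≡ 1ℚ
  s*k≡1 = ℚ.*-inverseʳ s
  -- The chord lines y = (a + b)z − ab and y = (c + d)z − cd meet at
  -- z = (ab − cd)/(a + b − c − d), written here so that c ≤ q ≤ b is evident.
  q = c + (c - a) * (b - c) * k
  c≤q : c ≤ q
  c≤q = p≤p+q c (0≤p*q (0≤p*q (ℚ.<⇒≤ (p<q⇒0<q-p a<c)) (ℚ.<⇒≤ (p<q⇒0<q-p c<b))) 0≤k)
  a≤q = ℚ.≤-trans (ℚ.<⇒≤ a<c) c≤q
  q+gap≡b : q + (b - c) * (d - b) * k ≡ b
  q+gap≡b = begin
    q + (b - c) * (d - b) * k  ≡⟨ split a b c d k ⟩
    c + (b - c) * (s * k)      ≡⟨ cong (λ r → c + (b - c) * r) s*k≡1 ⟩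
    c + (b - c) * 1ℚ           ≡⟨ close b c ⟩
    b                          ∎
    where
    split : ∀ a b c d k → c + (c - a) * (b - c) * k + (b - c) * (d - b) * k
                          ≡ c + (b - c) * (((c - a) + (d - b)) * k)
    split = solve-∀ ℚ-ring
    close : ∀ b c → c + (b - c) * 1ℚ ≡ b
    close = solve-∀ ℚ-ring
  q≤b : q ≤ b
  q≤b = subst (q ≤_) q+gap≡b
          (p≤p+q q (0≤p*q (0≤p*q (ℚ.<⇒≤ (p<q⇒0<q-p c<b)) (ℚ.<⇒≤ (p<q⇒0<q-p b<d))) 0≤k))
  q≤d = ℚ.≤-trans q≤b (ℚ.<⇒≤ b<d)
  chords-meet : (a + b) * q - a * b ≡ (c + d) * q - c * d
  chords-meet = begin
    (a + b) * q - a * b                                     ≡⟨ difference a b c d k ⟩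
    (c + d) * q - c * d + (c - a) * (b - c) * (1ℚ - s * k)  ≡⟨ cong (λ r → e + f * (1ℚ - r)) s*k≡1 ⟩
    (c + d) * q - c * d + (c - a) * (b - c) * (1ℚ - 1ℚ)     ≡⟨ vanish e f ⟩
    (c + d) * q - c * d                                     ∎
    where
    difference : ∀ a b c d k → let q = c + (c - a) * (b - c) * k in
      (a + b) * q - a * b ≡ (c + d) * q - c * d + (c - a) * (b - c) * (1ℚ - ((c - a) + (d - b)) * k)
    difference = solve-∀ ℚ-ring
    e = (c + d) * q - c * d
    f = (c - a) * (b - c)
    vanish : ∀ e f → e + f * (1ℚ - 1ℚ) ≡ e
    vanish = solve-∀ ℚ-ring

chord-leaving-interval-intersects : ∀ {A B C D} → OnParabola A → OnParabola B → OnParabola C → OnParabola D →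
  x C < x A × x A < x D → ¬ (x C < x B × x B < x D) → SegmentsIntersect A B C D
chord-leaving-interval-intersects {A} {B} {C} {D} pA pB pC pD (c<a , a<d) b∉ with ℚ.<-cmp (x B) (x C)
... | tri< b<c _ _ = SegmentsIntersect-swapˡ B A C D (interleaved-chords-intersect pB pA pC pD b<c c<a a<d)
... | tri≈ _ b≡c _ = touching⇒SegmentsIntersect A B C D b≡c (OnParabola-≡x⇒≡y pB pC b≡c)
... | tri> _ _ c<b with ℚ.<-cmp (x B) (x D)
...   | tri< b<d _ _ = ⊥-elim (b∉ (c<b , b<d))
...   | tri≈ _ b≡d _ = SegmentsIntersect-swapʳ A B D C
                         (touching⇒SegmentsIntersect A B D C b≡d (OnParabola-≡x⇒≡y pB pD b≡d))
...   | tri> _ _ d<b = SegmentsIntersect-sym C D A B (interleaved-chords-intersect pC pD pA pB c<a a<d d<b)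

parabola-¬collinear : ∀ {A B C} → OnParabola A → OnParabola B → OnParabola C →
                      x A ≢ x B → x B ≢ x C → x A ≢ x C → ¬ Collinear A B C
parabola-¬collinear {A} {B} {C} (onParabola yA≡) (onParabola yB≡) (onParabola yC≡) a≢b b≢c a≢c col
  with p*q≡0⇒p≡0∨q≡0 _ _ product≡0
  where
  open ≡-Reasoning
  a = x A
  b = x B
  c = x C
  product≡0 : (b - a) * (c - a) * (c - b) ≡ 0ℚ
  product≡0 = begin
    (b - a) * (c - a) * (c - b)                            ≡⟨ factorise a b c ⟩
    (b - a) * (c * c - a * a) - (b * b - a * a) * (c - a)  ≡⟨ cong₂ (λ u w → (b - a) * (w - u) - (b * b - u) * (c - a))
                                                                      (sym yA≡) (sym yC≡) ⟩
    (b - a) * (y C - y A) - (b * b - y A) * (c - a)        ≡⟨ cong (λ v → (b - a) * (y C - y A) - (v - y A) * (c - a))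
                                                                   (sym yB≡) ⟩
    (b - a) * (y C - y A) - (y B - y A) * (c - a)          ≡⟨ x≈y⇒x∙y⁻¹≈ε col ⟩
    0ℚ                                                     ∎
    where
    factorise : ∀ a b c → (b - a) * (c - a) * (c - b) ≡ (b - a) * (c * c - a * a) - (b * b - a * a) * (c - a)
    factorise = solve-∀ ℚ-ring
... | inj₂ c-b≡0 = b≢c (sym (x∙y⁻¹≈ε⇒x≈y (x C) (x B) c-b≡0))
... | inj₁ product≡0 with p*q≡0⇒p≡0∨q≡0 _ _ product≡0
...   | inj₁ b-a≡0 = a≢b (sym (x∙y⁻¹≈ε⇒x≈y (x B) (x A) b-a≡0))
...   | inj₂ c-a≡0 = a≢c (sym (x∙y⁻¹≈ε⇒x≈y (x C) (x A) c-a≡0))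

record Between (z u v : ℚ) : Set where
  constructor between
  field
    ⊓<z : u ⊓ v < z
    z<⊔ : z < u ⊔ v

between? : ∀ z u v → Dec (Between z u v)
between? z u v =
  map′ (λ (l , r) → between l r) (λ (between l r) → l , r) ((u ⊓ v ℚ.<? z) ×-dec (z ℚ.<? u ⊔ v))

Between-sym : ∀ {z u v} → Between z u v → Between z v u
Between-sym {z} {u} {v} (between ⊓<z z<⊔) =
  between (subst (_< z) (ℚ.⊓-comm u v) ⊓<z) (subst (z <_) (ℚ.⊔-comm u v) z<⊔)

Between-≤ : ∀ {z u v} → u ≤ v → Between z u v ⇔ (u < z × z < v)
Between-≤ {z} u≤v = mk⇔
  (λ (between ⊓<z z<⊔) → subst (_< z) ⊓≡u ⊓<z , subst (z <_) ⊔≡v z<⊔)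
  (λ (u<z , z<v) → between (subst (_< z) (sym ⊓≡u) u<z) (subst (z <_) (sym ⊔≡v) z<v))
  where
  ⊓≡u = ℚ.p≤q⇒p⊓q≡p u≤v
  ⊔≡v = ℚ.p≤q⇒p⊔q≡q u≤v

Separates : ℚ → ℚ → ℚ → ℚ → Set
Separates u v z₁ z₂ = (Between z₁ u v × ¬ Between z₂ u v) ⊎ (¬ Between z₁ u v × Between z₂ u v)

separates? : ∀ u v z₁ z₂ → Dec (Separates u v z₁ z₂)
separates? u v z₁ z₂ =
  (between? z₁ u v ×-dec ¬? (between? z₂ u v)) ⊎-dec (¬? (between? z₁ u v) ×-dec between? z₂ u v)

¬Separates⇒Between₁ : ∀ {u v z₁ z₂} → ¬ Separates u v z₁ z₂ → Between z₂ u v → Between z₁ u v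
¬Separates⇒Between₁ {u} {v} {z₁} ¬sep z₂∈ =
  decidable-stable (between? z₁ u v) (λ z₁∉ → ¬sep (inj₂ (z₁∉ , z₂∈)))

¬Separates⇒Between₂ : ∀ {u v z₁ z₂} → ¬ Separates u v z₁ z₂ → Between z₁ u v → Between z₂ u v
¬Separates⇒Between₂ {u} {v} {z₂ = z₂} ¬sep z₁∈ =
  decidable-stable (between? z₂ u v) (λ z₂∉ → ¬sep (inj₁ (z₁∈ , z₂∉)))

chord-entering-interval-intersects : ∀ {A B C D} → OnParabola A → OnParabola B → OnParabola C → OnParabola D →
  Between (x A) (x C) (x D) → ¬ Between (x B) (x C) (x D) → SegmentsIntersect A B C D
chord-entering-interval-intersects {A} {B} {C} {D} pA pB pC pD A∈ B∉ with ℚ.≤-total (x C) (x D)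
... | inj₁ c≤d =
  chord-leaving-interval-intersects pA pB pC pD (to (Between-≤ c≤d) A∈) (B∉ ∘ from (Between-≤ c≤d))
... | inj₂ d≤c = SegmentsIntersect-swapʳ A B D C (chord-leaving-interval-intersects pA pB pD pC
  (to (Between-≤ d≤c) (Between-sym A∈)) (B∉ ∘ Between-sym ∘ from (Between-≤ d≤c)))

separated-chords-intersect : ∀ {A B C D} → OnParabola A → OnParabola B → OnParabola C → OnParabola D →
  Separates (x C) (x D) (x A) (x B) → SegmentsIntersect A B C D
separated-chords-intersect pA pB pC pD (inj₁ (A∈ , B∉)) =
  chord-entering-interval-intersects pA pB pC pD A∈ B∉
separated-chords-intersect {A} {B} {C} {D} pA pB pC pD (inj₂ (A∉ , B∈)) =
  SegmentsIntersect-swapˡ B A C D (chord-entering-interval-intersects pB pA pC pD B∈ A∉)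

xAt : Input → ℕ → ℚ
xAt ps i = x (at ps i)

All-at : ∀ {P : WPoint → Set} {ps i} → All P ps → i ℕ.< length ps → P (at ps i)
All-at {i = zero}  (Pp ∷ _)   _          = Pp
All-at {i = suc i} (_  ∷ Pps) (ℕ.s≤s i<) = All-at Pps i<

lookup≡at : ∀ (ps : Input) i → lookup ps i ≡ at ps (toℕ i)
lookup≡at (p ∷ ps) Fin.zero    = refl
lookup≡at (p ∷ ps) (Fin.suc i) = lookup≡at ps i

length-∷ʳ : ∀ (ps : Input) p → length (ps ∷ʳ p) ≡ suc (length ps)
length-∷ʳ []       p = refl
length-∷ʳ (q ∷ ps) p = cong suc (length-∷ʳ ps p)

<-length-∷ʳ : ∀ {i} ps p → i ℕ.< length (ps ∷ʳ p) → i ℕ.< length ps ⊎ i ≡ length ps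
<-length-∷ʳ ps p i< = ℕ.m<1+n⇒m<n∨m≡n (subst (_ ℕ.<_) (length-∷ʳ ps p) i<)

at-∷ʳ-< : ∀ {i} ps p → i ℕ.< length ps → at (ps ∷ʳ p) i ≡ at ps i
at-∷ʳ-< {zero}  (q ∷ ps) p _          = refl
at-∷ʳ-< {suc i} (q ∷ ps) p (ℕ.s≤s i<) = at-∷ʳ-< ps p i<

at-∷ʳ-length : ∀ ps p → at (ps ∷ʳ p) (length ps) ≡ p
at-∷ʳ-length []       p = refl
at-∷ʳ-length (q ∷ ps) p = at-∷ʳ-length ps p

record ParabolicInput (ps : Input) : Set where
  field
    all-onParabola : All OnParabola ps
    x-injective    : ∀ {i j} → i ℕ.< length ps → j ℕ.< length ps → xAt ps i ≡ xAt ps j → i ≡ j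
open ParabolicInput

Fresh : Input → ℚ → Set
Fresh ps z = All (λ p → x p ≢ z) ps

ParabolicInput-[] : ParabolicInput []
ParabolicInput-[] = record { all-onParabola = [] ; x-injective = λ () }

ParabolicInput-∷ʳ : ∀ {ps z} → ParabolicInput ps → Fresh ps z → ParabolicInput (ps ∷ʳ parabola z)
ParabolicInput-∷ʳ {ps} {z} par fresh = record
  { all-onParabola = All.∷ʳ⁺ (all-onParabola par) (parabola-onParabola z)
  ; x-injective    = x-injective′
  }
  where
  ps′ = ps ∷ʳ parabola z
  old : ∀ {i} → i ℕ.< length ps → xAt ps′ i ≡ xAt ps i
  old i< = cong x (at-∷ʳ-< ps (parabola z) i<)
  new : xAt ps′ (length ps) ≡ z
  new = cong x (at-∷ʳ-length ps (parabola z))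
  x-injective′ : ∀ {i j} → i ℕ.< length ps′ → j ℕ.< length ps′ → xAt ps′ i ≡ xAt ps′ j → i ≡ j
  x-injective′ i< j< eq with <-length-∷ʳ ps (parabola z) i< | <-length-∷ʳ ps (parabola z) j<
  ... | inj₁ i<k  | inj₁ j<k  = x-injective par i<k j<k (trans (sym (old i<k)) (trans eq (old j<k)))
  ... | inj₁ i<k  | inj₂ refl = ⊥-elim (All-at fresh i<k (trans (sym (old i<k)) (trans eq new)))
  ... | inj₂ refl | inj₁ j<k  = ⊥-elim (All-at fresh j<k (trans (sym (old j<k)) (trans (sym eq) new)))
  ... | inj₂ refl | inj₂ refl = refl

ParabolicInput⇒GeneralPosition : ∀ {ps} → ParabolicInput ps → GeneralPosition ps
ParabolicInput⇒GeneralPosition {ps} par =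
  (λ i j i≢j same → x≢ i≢j (proj₁ same)) ,
  (λ i j k i≢j j≢k i≢k → parabola-¬collinear (onP i) (onP j) (onP k) (x≢ i≢j) (x≢ j≢k) (x≢ i≢k))
  where
  onP : ∀ i → OnParabola (lookup ps i)
  onP i = subst OnParabola (sym (lookup≡at ps i)) (All-at (all-onParabola par) (Fin.toℕ<n i))
  x≢ : ∀ {i j} → i ≢ j → x (lookup ps i) ≢ x (lookup ps j)
  x≢ {i} {j} i≢j eq = i≢j (Fin.toℕ-injective (x-injective par (Fin.toℕ<n i) (Fin.toℕ<n j)
    (trans (sym (cong x (lookup≡at ps i))) (trans eq (cong x (lookup≡at ps j))))))

_∈ₑ_ : ℕ → Edge → Set
i ∈ₑ (u , v) = u ≡ i ⊎ v ≡ i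

_∈ₑ?_ : ∀ i e → Dec (i ∈ₑ e)
i ∈ₑ? (u , v) = (u ℕ.≟ i) ⊎-dec (v ℕ.≟ i)

EdgesIntersect : Input → Edge → Edge → Set
EdgesIntersect ps (u , v) (u′ , v′) = SegmentsIntersect (at ps u) (at ps v) (at ps u′) (at ps v′)

sharedEndpoint⇒EdgesIntersect : ∀ ps {e f i} → i ∈ₑ e → i ∈ₑ f → EdgesIntersect ps e f
sharedEndpoint⇒EdgesIntersect ps {u , v} {_ , v′} (inj₁ refl) (inj₁ refl) =
  SegmentsIntersect-swapˡ (at ps v) (at ps u) (at ps u) (at ps v′)
    (touching⇒SegmentsIntersect (at ps v) (at ps u) (at ps u) (at ps v′) refl refl)
sharedEndpoint⇒EdgesIntersect ps {u , v} {u′ , _} (inj₁ refl) (inj₂ refl) =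
  SegmentsIntersect-swapˡ (at ps v) (at ps u) (at ps u′) (at ps u)
    (SegmentsIntersect-swapʳ (at ps v) (at ps u) (at ps u) (at ps u′)
      (touching⇒SegmentsIntersect (at ps v) (at ps u) (at ps u) (at ps u′) refl refl))
sharedEndpoint⇒EdgesIntersect ps {u , v} {_ , v′} (inj₂ refl) (inj₁ refl) =
  touching⇒SegmentsIntersect (at ps u) (at ps v) (at ps v) (at ps v′) refl refl
sharedEndpoint⇒EdgesIntersect ps {u , v} {u′ , _} (inj₂ refl) (inj₂ refl) =
  SegmentsIntersect-swapʳ (at ps u) (at ps v) (at ps v) (at ps u′)
    (touching⇒SegmentsIntersect (at ps u) (at ps v) (at ps v) (at ps u′) refl refl)

module NonCrossing {ps M} (nc : NonCrossingMatching ps M) where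

  edge-valid : ∀ a → ValidEdge ps (lookup M a)
  edge-valid a = All.lookup (proj₁ nc) (∈-lookup a)

  endpoint-< : ∀ {i} a → i ∈ₑ lookup M a → i ℕ.< length ps
  endpoint-< a (inj₁ refl) = ℕ.<-trans (proj₁ (edge-valid a)) (proj₂ (edge-valid a))
  endpoint-< a (inj₂ refl) = proj₂ (edge-valid a)

  sharedEndpoint⇒≡ : ∀ {i} a b → i ∈ₑ lookup M a → i ∈ₑ lookup M b → a ≡ b
  sharedEndpoint⇒≡ a b i∈a i∈b =
    decidable-stable (a Fin.≟ b) (λ a≢b → proj₂ nc a b a≢b (sharedEndpoint⇒EdgesIntersect ps i∈a i∈b))

Free : Matching → ℕ → Set
Free M j = ∀ a → ¬ j ∈ₑ lookup M a

free? : ∀ M j → Dec (Free M j)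
free? M j = Fin.all? λ a → ¬? (j ∈ₑ? lookup M a)

Covers : Input → Edge → ℚ → Set
Covers ps (u , v) z = Between z (xAt ps u) (xAt ps v)

EdgeSeparates : Input → Edge → ℚ → ℚ → Set
EdgeSeparates ps (u , v) = Separates (xAt ps u) (xAt ps v)

edgeSeparates? : ∀ ps e z₁ z₂ → Dec (EdgeSeparates ps e z₁ z₂)
edgeSeparates? ps (u , v) = separates? (xAt ps u) (xAt ps v)

Visible : Input → Matching → ℚ → ℕ → Set
Visible ps M z j = ∀ a → ¬ EdgeSeparates ps (lookup M a) z (xAt ps j)

VisibleFreePoint : Input → Matching → ℚ → Set
VisibleFreePoint ps M z = ∃ λ (j : Fin (length ps)) → Free M (toℕ j) × Visible ps M z (toℕ j)

Pocket : Input → Matching → ℚ → Set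
Pocket ps M z = ¬ VisibleFreePoint ps M z

visibleFreePoint? : ∀ ps M z → Dec (VisibleFreePoint ps M z)
visibleFreePoint? ps M z = Fin.any? λ j →
  free? M (toℕ j) ×-dec Fin.all? (λ a → ¬? (edgeSeparates? ps (lookup M a) z (xAt ps (toℕ j))))

extension⇒VisibleFreePoint : ∀ {ps M z j} → ParabolicInput ps → NonCrossingMatching ps M → j ℕ.< length ps →
  NonCrossingMatching (ps ∷ʳ parabola z) ((j , length ps) ∷ M) → VisibleFreePoint ps M z
extension⇒VisibleFreePoint {ps} {M} {z} {j} par nc j<k nc′ =
  fromℕ< j<k , subst (Free M) (sym toℕ-j) free , subst (Visible ps M z) (sym toℕ-j) visible
  where
  toℕ-j = Fin.toℕ-fromℕ< j<k
  ps′ = ps ∷ʳ parabola z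
  new-edge-disjoint : ∀ a → ¬ EdgesIntersect ps′ (j , length ps) (lookup M a)
  new-edge-disjoint a = proj₂ nc′ Fin.zero (Fin.suc a) (λ ())
  free : Free M j
  free a j∈a = new-edge-disjoint a (sharedEndpoint⇒EdgesIntersect ps′ (inj₁ refl) j∈a)
  visible : Visible ps M z j
  visible a sep = new-edge-disjoint a (SegmentsIntersect-cong
    (sym (at-∷ʳ-< ps (parabola z) j<k)) (sym (at-∷ʳ-length ps (parabola z)))
    (sym (at-∷ʳ-< ps (parabola z) u<k)) (sym (at-∷ʳ-< ps (parabola z) v<k))
    (SegmentsIntersect-swapˡ (parabola z) (at ps j) (at ps u) (at ps v)
      (separated-chords-intersect (parabola-onParabola z) (onP j<k) (onP u<k) (onP v<k) sep)))
    where
    onP : ∀ {i} → i ℕ.< length ps → OnParabola (at ps i)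
    onP = All-at (all-onParabola par)
    u = proj₁ (lookup M a)
    v = proj₂ (lookup M a)
    u<k = NonCrossing.endpoint-< {ps} {M} nc a (inj₁ refl)
    v<k = NonCrossing.endpoint-< {ps} {M} nc a (inj₂ refl)

RemoveStep-length : ∀ {M M₀} → RemoveStep M M₀ → length M₀ ℕ.≤ length M
RemoveStep-length           (inj₁ refl)         = ℕ.≤-refl
RemoveStep-length {M₀ = M₀} (inj₂ (_ , M↭e∷M₀)) =
  subst (length M₀ ℕ.≤_) (sym (↭-length M↭e∷M₀)) (ℕ.n≤1+n _)

AddStep-length : ∀ {n M₀ M′} → AddStep n M₀ M′ → length M′ ℕ.≤ suc (length M₀)
AddStep-length (inj₁ refl)           = ℕ.n≤1+n _
AddStep-length (inj₂ (_ , _ , refl)) = ℕ.≤-refl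

RevocableStep-length : ∀ {n M M′} → RevocableStep n M M′ → length M′ ℕ.≤ suc (length M)
RevocableStep-length (_ , remove , add) = ℕ.≤-trans (AddStep-length add) (ℕ.s≤s (RemoveStep-length remove))

pocket-RevocableStep-length : ∀ {ps M M′ z} → ParabolicInput ps → NonCrossingMatching ps M → Pocket ps M z →
  RevocableStep (length ps) M M′ → NonCrossingMatching (ps ∷ʳ parabola z) M′ → length M′ ℕ.≤ length M
pocket-RevocableStep-length {M′ = M′} _ _ _ (_ , inj₂ (_ , M↭e∷M₀) , add) _ =
  subst (length M′ ℕ.≤_) (sym (↭-length M↭e∷M₀)) (AddStep-length add)
pocket-RevocableStep-length _ _ _ (_ , inj₁ refl , inj₁ refl) _ = ℕ.≤-refl
pocket-RevocableStep-length par nc pocket (_ , inj₁ refl , inj₂ (_ , j<k , refl)) nc′ =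
  ⊥-elim (pocket (extension⇒VisibleFreePoint par nc j<k nc′))

-- Candidate positions for the next point and the bound they force

leftOf : Input → ℚ
leftOf []       = 0ℚ
leftOf (p ∷ ps) = (x p - 1ℚ) ⊓ leftOf ps

leftOf-< : ∀ ps → All (λ p → leftOf ps < x p) ps
leftOf-< []       = []
leftOf-< (p ∷ ps) =
  ℚ.≤-<-trans (ℚ.p⊓q≤p _ _) p-1<p ∷ All.map (ℚ.≤-<-trans (ℚ.p⊓q≤q (x p - 1ℚ) _)) (leftOf-< ps)
  where
  p-1<p : x p - 1ℚ < x p
  p-1<p = subst (x p - 1ℚ <_) (p-1+1≡p (x p)) (p<p+q (x p - 1ℚ) (ℚ.positive⁻¹ 1ℚ))
    where
    p-1+1≡p : ∀ p → p - 1ℚ + 1ℚ ≡ p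
    p-1+1≡p = solve-∀ ℚ-ring

leftOf-fresh : ∀ ps → Fresh ps (leftOf ps)
leftOf-fresh ps = All.map (λ leftOf<p p≡leftOf → ℚ.<-irrefl (sym p≡leftOf) leftOf<p) (leftOf-< ps)

gapAbove : ∀ u ps → ∃ λ v → u < v × All (λ p → x p ≤ u ⊎ v < x p) ps
gapAbove u [] = u + 1ℚ , p<p+q u (ℚ.positive⁻¹ 1ℚ) , []
gapAbove u (p ∷ ps) with gapAbove u ps | u ℚ.<? x p
... | v , u<v , gap | no u≮p  = v , u<v , inj₁ (ℚ.≮⇒≥ u≮p) ∷ gap
... | v , u<v , gap | yes u<p =
  let v′ , u<v′ , v′<p⊓v = ℚ.<-dense (<-⊓ u<p u<v) in
  v′ , u<v′ , inj₂ (ℚ.<-≤-trans v′<p⊓v (ℚ.p⊓q≤p (x p) v)) ∷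
  All.map (Sum.map₂ (ℚ.<-trans (ℚ.<-≤-trans v′<p⊓v (ℚ.p⊓q≤q (x p) v)))) gap

justAbove : ℚ → Input → ℚ
justAbove u ps = proj₁ (gapAbove u ps)

justAbove-> : ∀ u ps → u < justAbove u ps
justAbove-> u ps = proj₁ (proj₂ (gapAbove u ps))

justAbove-gap : ∀ u ps → All (λ p → x p ≤ u ⊎ justAbove u ps < x p) ps
justAbove-gap u ps = proj₂ (proj₂ (gapAbove u ps))

justAbove-< : ∀ {u} ps {i} → i ℕ.< length ps → u < xAt ps i → justAbove u ps < xAt ps i
justAbove-< ps i< u<xᵢ with All-at (justAbove-gap _ ps) i<
... | inj₁ xᵢ≤u     = ⊥-elim (ℚ.<-irrefl refl (ℚ.<-≤-trans u<xᵢ xᵢ≤u))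
... | inj₂ above<xᵢ = above<xᵢ

justAbove-fresh : ∀ u ps → Fresh ps (justAbove u ps)
justAbove-fresh u ps = All.map (λ {p} → fresh {p}) (justAbove-gap u ps)
  where
  fresh : ∀ {p} → x p ≤ u ⊎ justAbove u ps < x p → x p ≢ justAbove u ps
  fresh (inj₁ p≤u)     p≡above =
    ℚ.<-irrefl refl (ℚ.≤-<-trans (subst (_≤ u) p≡above p≤u) (justAbove-> u ps))
  fresh (inj₂ above<p) p≡above = ℚ.<-irrefl (sym p≡above) above<p

lower : Input → Edge → ℚ
lower ps (u , v) = xAt ps u ⊓ xAt ps v

justInside : (ps : Input) (M : Matching) → Fin (length M) → ℚ
justInside ps M a = justAbove (lower ps (lookup M a)) ps

NoCandidatePocket : Input → Matching → Set
NoCandidatePocket ps M = VisibleFreePoint ps M (leftOf ps) × (∀ a → VisibleFreePoint ps M (justInside ps M a))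

selects-endpoint : ∀ {_∙_ : ℚ → ℚ → ℚ} → Selective _≡_ _∙_ →
                   ∀ ps e → ∃ λ i → i ∈ₑ e × xAt ps (proj₁ e) ∙ xAt ps (proj₂ e) ≡ xAt ps i
selects-endpoint sel ps (u , v) =
  [ (λ eq → u , inj₁ refl , eq) , (λ eq → v , inj₂ refl , eq) ]′ (sel (xAt ps u) (xAt ps v))

[,]∘splitAt-injective : ∀ {m n} {B : Set} {f : Fin m → B} {g : Fin n → B} →
  Injective _≡_ _≡_ f → Injective _≡_ _≡_ g → (∀ i j → f i ≢ g j) →
  Injective _≡_ _≡_ ([ f , g ]′ ∘ Fin.splitAt m)
[,]∘splitAt-injective {m} {n} {f = f} {g} f-inj g-inj f≢g {i} {j} eq =
  Injection.injective (↔⇒↣ (Fin.+↔⊎ {m} {n})) ([f,g]-injective (Fin.splitAt m i) (Fin.splitAt m j) eq)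
  where
  [f,g]-injective : ∀ s t → [ f , g ]′ s ≡ [ f , g ]′ t → s ≡ t
  [f,g]-injective (inj₁ a) (inj₁ b) eq = cong inj₁ (f-inj eq)
  [f,g]-injective (inj₁ a) (inj₂ b) eq = ⊥-elim (f≢g a b eq)
  [f,g]-injective (inj₂ a) (inj₁ b) eq = ⊥-elim (f≢g b a (sym eq))
  [f,g]-injective (inj₂ a) (inj₂ b) eq = cong inj₂ (g-inj eq)

injective-bounded⇒≤ : ∀ {n k} (f : Fin n → ℕ) → Injective _≡_ _≡_ f → (∀ i → f i ℕ.< k) → n ℕ.≤ k
injective-bounded⇒≤ f f-inj f<k = Fin.injective⇒≤ {f = λ i → fromℕ< (f<k i)} λ {i} {j} eq →
  f-inj (trans (sym (Fin.toℕ-fromℕ< (f<k i))) (trans (cong toℕ eq) (Fin.toℕ-fromℕ< (f<k j))))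

module EndpointsAndWitnesses {ps M} (par : ParabolicInput ps) (nc : NonCrossingMatching ps M)
                             (noPocket : NoCandidatePocket ps M) where

  open NonCrossing {ps} {M} nc

  m = length M
  k = length ps

  src tgt : Fin m → ℕ
  src a = proj₁ (lookup M a)
  tgt a = proj₂ (lookup M a)

  lo : Fin m → ℚ
  lo a = lower ps (lookup M a)

  outer : ℕ
  outer = toℕ (proj₁ (proj₁ noPocket))

  inner : Fin m → ℕ
  inner a = toℕ (proj₁ (proj₂ noPocket a))

  outer-visible : Visible ps M (leftOf ps) outer
  outer-visible = proj₂ (proj₂ (proj₁ noPocket))

  inner-visible : ∀ a → Visible ps M (justInside ps M a) (inner a)
  inner-visible a = proj₂ (proj₂ (proj₂ noPocket a))

  src≢tgt : ∀ a b → src a ≢ tgt b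
  src≢tgt a b eq = ℕ.<⇒≢ (proj₁ (edge-valid b))
    (subst (λ c → src c ≡ tgt b) (sharedEndpoint⇒≡ a b (inj₁ refl) (inj₂ (sym eq))) eq)

  lo<hi : ∀ a → lo a < xAt ps (src a) ⊔ xAt ps (tgt a)
  lo<hi a = ⊓<⊔ λ eq →
    src≢tgt a a (x-injective par (endpoint-< a (inj₁ refl)) (endpoint-< a (inj₂ refl)) eq)

  justInside-covered : ∀ a → Covers ps (lookup M a) (justInside ps M a)
  justInside-covered a with selects-endpoint ℚ.⊔-sel ps (lookup M a)
  ... | i , i∈a , hi≡xᵢ = between (justAbove-> (lo a) ps)
    (subst (_ <_) (sym hi≡xᵢ) (justAbove-< ps (endpoint-< a i∈a) (subst (lo a <_) hi≡xᵢ (lo<hi a))))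

  inner-covered : ∀ a → Covers ps (lookup M a) (xAt ps (inner a))
  inner-covered a = ¬Separates⇒Between₂ (inner-visible a a) (justInside-covered a)

  leftOf-uncovered : ∀ a → ¬ Covers ps (lookup M a) (leftOf ps)
  leftOf-uncovered a (between lo<leftOf _) with selects-endpoint ℚ.⊓-sel ps (lookup M a)
  ... | i , i∈a , lo≡xᵢ =
    ℚ.<-asym lo<leftOf (subst (leftOf ps <_) (sym lo≡xᵢ) (All-at (leftOf-< ps) (endpoint-< a i∈a)))

  inner≢outer : ∀ a → inner a ≢ outer
  inner≢outer a eq =
    outer-visible a (inj₂ (leftOf-uncovered a , subst (Covers ps (lookup M a) ∘ xAt ps) eq (inner-covered a)))

  covers-justInside⇒lo-≤ : ∀ a b → Covers ps (lookup M b) (justInside ps M a) → lo b ≤ lo a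
  covers-justInside⇒lo-≤ a b (between loᵇ<above _) with selects-endpoint ℚ.⊓-sel ps (lookup M b)
  ... | i , i∈b , loᵇ≡xᵢ = ℚ.≮⇒≥ λ loᵃ<loᵇ → ℚ.<-asym loᵇ<above
    (subst (_ <_) (sym loᵇ≡xᵢ) (justAbove-< ps (endpoint-< b i∈b) (subst (lo a <_) loᵇ≡xᵢ loᵃ<loᵇ)))

  lo-injective : ∀ a b → lo a ≡ lo b → a ≡ b
  lo-injective a b eq with selects-endpoint ℚ.⊓-sel ps (lookup M a) | selects-endpoint ℚ.⊓-sel ps (lookup M b)
  ... | i , i∈a , loᵃ≡xᵢ | j , j∈b , loᵇ≡xⱼ =
    sharedEndpoint⇒≡ a b i∈a (subst (_∈ₑ lookup M b) (sym i≡j) j∈b)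
    where
    i≡j = x-injective par (endpoint-< a i∈a) (endpoint-< b j∈b)
            (trans (sym loᵃ≡xᵢ) (trans eq loᵇ≡xⱼ))

  -- A free point seen from just inside both a and b is covered by both edges, so
  -- neither edge may leave the other's candidate uncovered; hence lo a ≡ lo b.
  inner-injective : Injective _≡_ _≡_ inner
  inner-injective {a} {b} eq =
    lo-injective a b (ℚ.≤-antisym (covers-justInside⇒lo-≤ b a b∈a) (covers-justInside⇒lo-≤ a b a∈b))
    where
    a∈b : Covers ps (lookup M b) (justInside ps M a)
    a∈b = ¬Separates⇒Between₁ (inner-visible a b)
            (subst (Covers ps (lookup M b) ∘ xAt ps) (sym eq) (inner-covered b))
    b∈a : Covers ps (lookup M a) (justInside ps M b)
    b∈a = ¬Separates⇒Between₁ (inner-visible b a)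
            (subst (Covers ps (lookup M a) ∘ xAt ps) eq (inner-covered a))

  endpoint : Fin (m ℕ.+ m) → ℕ
  endpoint = [ src , tgt ]′ ∘ Fin.splitAt m

  witness : Fin (m ℕ.+ 1) → ℕ
  witness = [ inner , (λ _ → outer) ]′ ∘ Fin.splitAt m

  point : Fin ((m ℕ.+ m) ℕ.+ (m ℕ.+ 1)) → ℕ
  point = [ endpoint , witness ]′ ∘ Fin.splitAt (m ℕ.+ m)

  endpoint-matched : ∀ i → ∃ λ a → endpoint i ∈ₑ lookup M a
  endpoint-matched i with Fin.splitAt m i
  ... | inj₁ a = a , inj₁ refl
  ... | inj₂ a = a , inj₂ refl

  witness-free : ∀ j → Free M (witness j)
  witness-free j with Fin.splitAt m j
  ... | inj₁ a = proj₁ (proj₂ (proj₂ noPocket a))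
  ... | inj₂ _ = proj₁ (proj₂ (proj₁ noPocket))

  point-< : ∀ i → point i ℕ.< k
  point-< i with Fin.splitAt (m ℕ.+ m) i
  ... | inj₁ i′ = endpoint-< (proj₁ (endpoint-matched i′)) (proj₂ (endpoint-matched i′))
  ... | inj₂ j with Fin.splitAt m j
  ...   | inj₁ _ = Fin.toℕ<n _
  ...   | inj₂ _ = Fin.toℕ<n _

  point-injective : Injective _≡_ _≡_ point
  point-injective = [,]∘splitAt-injective
    ([,]∘splitAt-injective (λ {a} {b} eq → sharedEndpoint⇒≡ a b (inj₁ refl) (inj₁ (sym eq)))
                           (λ {a} {b} eq → sharedEndpoint⇒≡ a b (inj₂ refl) (inj₂ (sym eq)))
                           src≢tgt)
    ([,]∘splitAt-injective inner-injective (λ { {Fin.zero} {Fin.zero} _ → refl }) (λ a _ → inner≢outer a))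
    (λ i j eq → witness-free j (proj₁ (endpoint-matched i)) (subst (_∈ₑ _) eq (proj₂ (endpoint-matched i))))

  3*length<length : 3 ℕ.* m ℕ.< k
  3*length<length = subst (ℕ._≤ k) (count m) (injective-bounded⇒≤ point point-injective point-<)
    where
    count : ∀ m → (m ℕ.+ m) ℕ.+ (m ℕ.+ 1) ≡ suc (3 ℕ.* m)
    count = ℕ-solve-∀

NoCandidatePocket⇒3*length<length : ∀ {ps M} → ParabolicInput ps → NonCrossingMatching ps M →
                                     NoCandidatePocket ps M → 3 ℕ.* length M ℕ.< length ps
NoCandidatePocket⇒3*length<length = EndpointsAndWitnesses.3*length<length

-- The adversary

adversaryMove : ∀ ps M → ∃ λ z → Fresh ps z × (Pocket ps M z ⊎ NoCandidatePocket ps M)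
adversaryMove ps M with visibleFreePoint? ps M (leftOf ps)
... | no pocket = leftOf ps , leftOf-fresh ps , inj₁ pocket
... | yes outer with Fin.any? (λ a → ¬? (visibleFreePoint? ps M (justInside ps M a)))
...   | yes (a , pocket) = justInside ps M a , justAbove-fresh _ ps , inj₁ pocket
...   | no ¬pocket       = leftOf ps , leftOf-fresh ps , inj₂ (outer , λ a →
  decidable-stable (visibleFreePoint? ps M (justInside ps M a)) (λ pocket → ¬pocket (a , pocket)))

adversary : RevocableAlgorithm → ℕ → Input
adversary A zero    = []
adversary A (suc n) = ps ∷ʳ parabola (proj₁ (adversaryMove ps (run A ps)))
  where
  ps = adversary A n

adversary-length : ∀ A n → length (adversary A n) ≡ n
adversary-length A zero    = refl
adversary-length A (suc n) = trans (length-∷ʳ (adversary A n) _) (cong suc (adversary-length A n))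

adversary-parabolic : ∀ A n → ParabolicInput (adversary A n)
adversary-parabolic A zero    = ParabolicInput-[]
adversary-parabolic A (suc n) = ParabolicInput-∷ʳ (adversary-parabolic A n) (proj₁ (proj₂ (adversaryMove _ _)))

adversary-unitWeights : ∀ A n → All (λ p → w p ≡ 1ℚ) (adversary A n)
adversary-unitWeights A zero    = []
adversary-unitWeights A (suc n) = All.∷ʳ⁺ (adversary-unitWeights A n) refl

adversary-3*matching≤1+n : ∀ A n → 3 ℕ.* length (run A (adversary A n)) ℕ.≤ suc n
adversary-3*matching≤1+n A zero    = subst (λ M → 3 ℕ.* length M ℕ.≤ 1) (sym (run-empty A)) ℕ.z≤n
adversary-3*matching≤1+n A (suc n) = bound (proj₂ (proj₂ move))
  where
  open ℕ.≤-Reasoning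
  ps = adversary A n
  M = run A ps
  move = adversaryMove ps M
  ps′ = ps ∷ʳ parabola (proj₁ move)
  step = run-step A ps (parabola (proj₁ move))
  bound : Pocket ps M (proj₁ move) ⊎ NoCandidatePocket ps M → 3 ℕ.* length (run A ps′) ℕ.≤ suc (suc n)
  bound (inj₁ pocket) = begin
    3 ℕ.* length (run A ps′)  ≤⟨ ℕ.*-monoʳ-≤ 3 (pocket-RevocableStep-length (adversary-parabolic A n)
                                                  (run-valid A ps) pocket step (run-valid A ps′)) ⟩
    3 ℕ.* length M            ≤⟨ adversary-3*matching≤1+n A n ⟩
    suc n                     ≤⟨ ℕ.n≤1+n (suc n) ⟩
    suc (suc n)               ∎
  bound (inj₂ noPocket) = begin
    3 ℕ.* length (run A ps′)  ≤⟨ ℕ.*-monoʳ-≤ 3 (RevocableStep-length step) ⟩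
    3 ℕ.* suc (length M)      ≡⟨ ℕ.*-suc 3 (length M) ⟩
    3 ℕ.+ 3 ℕ.* length M      ≤⟨ ℕ.s≤s (ℕ.s≤s (subst (3 ℕ.* length M ℕ.<_) (adversary-length A n)
                                   (NoCandidatePocket⇒3*length<length (adversary-parabolic A n)
                                     (run-valid A ps) noPocket))) ⟩
    suc (suc n)               ∎

OPT-unitWeights : ∀ {ps} → All (λ p → w p ≡ 1ℚ) ps → OPT ps ≡ fromℕ (length ps)
OPT-unitWeights []           = refl
OPT-unitWeights (w≡1 ∷ unit) = trans (cong₂ _+_ w≡1 (OPT-unitWeights unit)) (sym (fromℕ-suc _))

profit-unitWeights : ∀ {ps} M → All (λ p → w p ≡ 1ℚ) ps → All (ValidEdge ps) M →
                     profit ps M ≡ fromℕ (2 ℕ.* length M)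
profit-unitWeights          []            _    []                    = refl
profit-unitWeights {ps} ((u , v) ∷ M) unit ((u<v , v<k) ∷ valid) = begin
  w (at ps u) + w (at ps v) + profit ps M  ≡⟨ cong₂ _+_ (cong₂ _+_ (All-at unit (ℕ.<-trans u<v v<k))
                                                                    (All-at unit v<k))
                                                         (profit-unitWeights M unit valid) ⟩
  1ℚ + 1ℚ + fromℕ (2 ℕ.* m)                ≡⟨ ℚ.+-assoc 1ℚ 1ℚ (fromℕ (2 ℕ.* m)) ⟩
  1ℚ + (1ℚ + fromℕ (2 ℕ.* m))              ≡⟨ cong (λ r → 1ℚ + r) (sym (fromℕ-suc (2 ℕ.* m))) ⟩
  1ℚ + fromℕ (suc (2 ℕ.* m))               ≡⟨ sym (fromℕ-suc (suc (2 ℕ.* m))) ⟩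
  fromℕ (2 ℕ.+ 2 ℕ.* m)                    ≡⟨ cong fromℕ (sym (ℕ.*-suc 2 m)) ⟩
  fromℕ (2 ℕ.* suc m)                      ∎
  where
  open ≡-Reasoning
  m = length M

3m≤n⇒fromℕ[2m]≤twoThirds*fromℕ[n] : ∀ {m n} → 3 ℕ.* m ℕ.≤ n → fromℕ (2 ℕ.* m) ≤ twoThirds * fromℕ n
3m≤n⇒fromℕ[2m]≤twoThirds*fromℕ[n] {m} {n} 3m≤n = begin
  fromℕ (2 ℕ.* m)                  ≡⟨ fromℕ-* 2 m ⟩
  fromℕ 2 * fromℕ m                ≡⟨ cong (_* fromℕ m) (ℚ.*-comm (fromℕ 3) twoThirds) ⟩
  twoThirds * fromℕ 3 * fromℕ m    ≡⟨ ℚ.*-assoc twoThirds (fromℕ 3) (fromℕ m) ⟩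
  twoThirds * (fromℕ 3 * fromℕ m)  ≡⟨ cong (twoThirds *_) (sym (fromℕ-* 3 m)) ⟩
  twoThirds * fromℕ (3 ℕ.* m)      ≤⟨ ℚ.*-monoˡ-≤-nonNeg twoThirds (fromℕ-mono-≤ 3m≤n) ⟩
  twoThirds * fromℕ n              ∎
  where
  open ℚ.≤-Reasoning

adversary-ALG : ∀ A n → ALG A (adversary A n) ≤ twoThirds * fromℕ (suc n)
adversary-ALG A n = begin
  ALG A ps                   ≡⟨ profit-unitWeights M (adversary-unitWeights A n) (proj₁ (run-valid A ps)) ⟩
  fromℕ (2 ℕ.* length M)     ≤⟨ 3m≤n⇒fromℕ[2m]≤twoThirds*fromℕ[n] {length M}
                                  (adversary-3*matching≤1+n A n) ⟩
  twoThirds * fromℕ (suc n)  ∎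
  where
  open ℚ.≤-Reasoning
  ps = adversary A n
  M = run A ps

theorem10 : (A : RevocableAlgorithm) (ρ : ℚ) → twoThirds < ρ → ¬ Competitive A ρ
theorem10 A ρ ⅔<ρ (c , competitive) = ℚ.<-irrefl refl (ℚ.<-≤-trans gap (begin
  ρ * fromℕ n - c            ≡⟨ cong (λ o → ρ * o - c) (sym OPT≡n) ⟩
  ρ * OPT I - c              ≤⟨ competitive I unitInstance ⟩
  ALG A I                    ≤⟨ adversary-ALG A n ⟩
  twoThirds * fromℕ (suc n)  ∎))
  where
  open ℚ.≤-Reasoning
  K = proj₁ (t<ρ⇒eventually-t*[1+n]<ρ*n-c c ⅔<ρ)
  gap = proj₂ (t<ρ⇒eventually-t*[1+n]<ρ*n-c c ⅔<ρ)
  n = 2 ℕ.* K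
  I = adversary A n
  OPT≡n : OPT I ≡ fromℕ n
  OPT≡n = trans (OPT-unitWeights (adversary-unitWeights A n)) (cong fromℕ (adversary-length A n))
  unitInstance : UnitInstance I
  unitInstance = (K , adversary-length A n) ,
                 ParabolicInput⇒GeneralPosition (adversary-parabolic A n) , adversary-unitWeights A n
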